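{- Let $G$ be a finite simple graph with $n$ vertices. If $G$ is $n$-symmetric, then either $G$ or its complement $\overline{G}$ has a Hamiltonian cycle.
   Context: Let $k$ be a positive integer. A graph $G$ is $k$-symmetric if its automorphism group $\mathrm{Aut}(G)$ contains a subgroup $\mathcal{H}$ isomorphic to the cyclic group $\mathbb{Z}_k$ which acts freely on the vertex set $V(G)$; a generator of such $\mathcal{H}$ is called a $k$-symmetric automorphism. -}

module Defs where

open import Data.Nat using (ℕ; zero; suc; _<_; _≤_)
open import Data.Nat.DivMod using (_%_; m%n<n)
open import Data.Bool using (Bool; true; false; not)
open import Data.Fin using (Fin; toℕ; fromℕ<; _≟_)
open import Data.Fin.Permutation using (Permutation′; _⟨$⟩ʳ_)
open import Data.Product using (Σ; _×_)
open import Relation.Nullary using (¬_; yes; no)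
open import Relation.Binary.PropositionalEquality using (_≡_)

record Graph (n : ℕ) : Set where
  field
    adj    : Fin n → Fin n → Bool
    sym    : ∀ u v → adj u v ≡ adj v u
    irrefl : ∀ v → adj v v ≡ false
open Graph public

Adj : ∀ {n} → Graph n → Fin n → Fin n → Set
Adj G u v = adj G u v ≡ true

complementAdj : ∀ {n} → Graph n → Fin n → Fin n → Bool
complementAdj G u v with u ≟ v
... | yes _ = false
... | no  _ = not (adj G u v)

private
  complSym : ∀ {n} (G : Graph n) u v → complementAdj G u v ≡ complementAdj G v u
  complSym G u v with u ≟ v | v ≟ u
  ... | yes _ | yes _ = _≡_.refl
  ... | yes p | no ¬q = Data.Empty.⊥-elim (¬q (Relation.Binary.PropositionalEquality.sym p))
    where import Data.Empty
  ... | no ¬p | yes q = Data.Empty.⊥-elim (¬p (Relation.Binary.PropositionalEquality.sym q))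
    where import Data.Empty
  ... | no _  | no _  = Relation.Binary.PropositionalEquality.cong not (Graph.sym G u v)

  complIrr : ∀ {n} (G : Graph n) v → complementAdj G v v ≡ false
  complIrr G v with v ≟ v
  ... | yes _ = _≡_.refl
  ... | no ¬p = Data.Empty.⊥-elim (¬p _≡_.refl)
    where import Data.Empty

complement : ∀ {n} → Graph n → Graph n
complement G = record
  { adj = complementAdj G ; sym = complSym G ; irrefl = complIrr G }

IsAutomorphism : ∀ {n} → Graph n → Permutation′ n → Set
IsAutomorphism G σ = ∀ u v → adj G (σ ⟨$⟩ʳ u) (σ ⟨$⟩ʳ v) ≡ adj G u v

pow : ∀ {n} → Permutation′ n → ℕ → Fin n → Fin n
pow σ zero    v = v
pow σ (suc j) v = σ ⟨$⟩ʳ (pow σ j v)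

-- σ is a k-symmetric automorphism of G: σ ∈ Aut(G), σ^k = id, and the
-- cyclic group ⟨σ⟩ = {σ^0, …, σ^(k-1)} ≅ ℤ_k acts freely, i.e. no σ^j with
-- 0 < j < k fixes any vertex (this also forces ⟨σ⟩ to have order exactly k
-- whenever the vertex set is nonempty).
IsKSymmetricAut : ∀ {n} → ℕ → Graph n → Permutation′ n → Set
IsKSymmetricAut {n} k G σ =
  IsAutomorphism G σ
  × (∀ v → pow σ k v ≡ v)
  × (∀ (j : ℕ) → 0 < j → j < k → ∀ v → ¬ (pow σ j v ≡ v))

KSymmetric : ∀ {n} → ℕ → Graph n → Set
KSymmetric {n} k G = (1 ≤ k) × Σ (Permutation′ n) (IsKSymmetricAut k G)

cycSucc : ∀ {n} → Fin n → Fin n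
cycSucc {suc m} i = fromℕ< (m%n<n (suc (toℕ i)) (suc m))

-- A Hamiltonian cycle: a cyclic ordering c(0), …, c(n-1) of all vertices
-- (a bijection Fin n → V) with c(i) adjacent to c(i+1 mod n) for all i.
-- (Meaningful as a cycle for n ≥ 3.)
HamiltonianCycle : ∀ {n} → Graph n → Set
HamiltonianCycle {n} G =
  Σ (Permutation′ n) λ c → ∀ (i : Fin n) → Adj G (c ⟨$⟩ʳ i) (c ⟨$⟩ʳ cycSucc i)

-- The orbit v, σ v, …, σⁿ⁻¹ v of a vertex under an n-symmetric automorphism σ
-- meets every vertex exactly once, and consecutive orbit points differ by σ.
-- As σ preserves adjacency, the pairs {σⁱ v, σⁱ⁺¹ v} are either all edges of G
-- or all non-edges, hence edges of the complement (of which σ is again an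
-- automorphism). Either way the orbit is a Hamiltonian cycle.
module Submission where

open import Defs hiding (sym)
open import Data.Nat using (ℕ; zero; suc; _+_; _*_; _∸_; _<_; _≤_; s≤s; z≤n; NonZero)
open import Data.Nat.Properties using (1+n≰n; m<n⇒0<n∸m; m∸n≤m; m∸n+n≡m; ≤-<-trans; <⇒≤; +-comm)
open import Data.Nat.DivMod using (_%_; _/_; m≡m%n+[m/n]*n)
open import Data.Fin using (Fin; zero; toℕ; punchOut; _≟_)
open import Data.Fin.Properties using (toℕ-fromℕ<; toℕ<n; any?; injective⇒≤; punchOut-injective; <-cmp)
open import Data.Fin.Permutation using (Permutation′; _⟨$⟩ʳ_; permutation)
open import Data.Bool using (true; false; not)
open import Data.Product using (_,_; proj₁; proj₂)
open import Data.Sum using (_⊎_; inj₁; inj₂)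
open import Data.Empty using (⊥-elim)
open import Function.Bundles using (Injection)
open import Function.Properties.Inverse using (↔⇒↣)
open import Function.Definitions using (Injective; StrictlySurjective)
open import Relation.Nullary using (yes; no)
open import Relation.Binary using (tri<; tri≈; tri>)
open import Relation.Binary.PropositionalEquality
  using (_≡_; _≢_; refl; sym; trans; cong; module ≡-Reasoning)

injective⇒surjective : ∀ {n} {f : Fin n → Fin n} → Injective _≡_ _≡_ f → StrictlySurjective _≡_ f
injective⇒surjective {suc m} {f} f-inj w with any? (λ i → f i ≟ w)
... | yes hit = hit
... | no miss = ⊥-elim (1+n≰n (injective⇒≤ punchOut∘f-injective))
  where
  w≢f : ∀ i → w ≢ f i
  w≢f i w≡fi = miss (i , sym w≡fi)

  punchOut∘f-injective : Injective _≡_ _≡_ (λ i → punchOut (w≢f i))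
  punchOut∘f-injective eq = f-inj (punchOut-injective (w≢f _) (w≢f _) eq)

-- The resulting permutation applies as f definitionally.
injective⇒permutation : ∀ {n} (f : Fin n → Fin n) → Injective _≡_ _≡_ f → Permutation′ n
injective⇒permutation f f-inj = permutation f preimage
  (λ w → proj₂ (injective⇒surjective f-inj w))
  (λ i → f-inj (proj₂ (injective⇒surjective f-inj (f i))))
  where
  preimage : Fin _ → Fin _
  preimage w = proj₁ (injective⇒surjective f-inj w)

module _ {n} (σ : Permutation′ n) where

  pow-+ : ∀ a b v → pow σ (a + b) v ≡ pow σ a (pow σ b v)
  pow-+ zero    b v = refl
  pow-+ (suc a) b v = cong (σ ⟨$⟩ʳ_) (pow-+ a b v)

  pow-comm : ∀ k v → pow σ k (σ ⟨$⟩ʳ v) ≡ σ ⟨$⟩ʳ pow σ k v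
  pow-comm k v = begin
    pow σ k (σ ⟨$⟩ʳ v)   ≡⟨ sym (pow-+ k 1 v) ⟩
    pow σ (k + 1) v      ≡⟨ cong (λ j → pow σ j v) (+-comm k 1) ⟩
    σ ⟨$⟩ʳ pow σ k v     ∎
    where open ≡-Reasoning

  module _ (k : ℕ) (period : ∀ v → pow σ k v ≡ v) where

    pow-multiple : ∀ q v → pow σ (q * k) v ≡ v
    pow-multiple zero    v = refl
    pow-multiple (suc q) v =
      trans (pow-+ k (q * k) v) (trans (cong (pow σ k) (pow-multiple q v)) (period v))

    pow-% : .{{_ : NonZero k}} → ∀ j v → pow σ (j % k) v ≡ pow σ j v
    pow-% j v = begin
      pow σ (j % k) v                     ≡⟨ cong (pow σ (j % k)) (sym (pow-multiple (j / k) v)) ⟩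
      pow σ (j % k) (pow σ (j / k * k) v) ≡⟨ sym (pow-+ (j % k) (j / k * k) v) ⟩
      pow σ (j % k + j / k * k) v         ≡⟨ cong (λ i → pow σ i v) (sym (m≡m%n+[m/n]*n j k)) ⟩
      pow σ j v                           ∎
      where open ≡-Reasoning

  module _ {k} (free : ∀ j → 0 < j → j < k → ∀ v → pow σ j v ≢ v) where

    pow-injective-< : ∀ {a b} v → a < b → b < k → pow σ a v ≢ pow σ b v
    pow-injective-< {a} {b} v a<b b<k σᵃv≡σᵇv =
      free (b ∸ a) (m<n⇒0<n∸m a<b) (≤-<-trans (m∸n≤m b a) b<k) (pow σ a v) (begin
        pow σ (b ∸ a) (pow σ a v) ≡⟨ sym (pow-+ (b ∸ a) a v) ⟩
        pow σ (b ∸ a + a) v       ≡⟨ cong (λ j → pow σ j v) (m∸n+n≡m (<⇒≤ a<b)) ⟩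
        pow σ b v                 ≡⟨ sym σᵃv≡σᵇv ⟩
        pow σ a v                 ∎)
      where open ≡-Reasoning

toℕ-cycSucc : ∀ {m} (i : Fin (suc m)) → toℕ (cycSucc i) ≡ suc (toℕ i) % suc m
toℕ-cycSucc {m} i = toℕ-fromℕ< {m = suc (toℕ i) % suc m} _

orbit : ∀ {n} → Permutation′ n → Fin n → Fin n → Fin n
orbit σ v i = pow σ (toℕ i) v

module _ {m} {σ : Permutation′ (suc m)} where

  orbit-injective : (∀ j → 0 < j → j < suc m → ∀ v → pow σ j v ≢ v) →
                    ∀ v → Injective _≡_ _≡_ (orbit σ v)
  orbit-injective free v {i} {j} eq with <-cmp i j
  ... | tri< i<j _ _ = ⊥-elim (pow-injective-< σ free v i<j (toℕ<n j) eq)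
  ... | tri≈ _ i≡j _ = i≡j
  ... | tri> _ _ j<i = ⊥-elim (pow-injective-< σ free v j<i (toℕ<n i) (sym eq))

  orbit-cycSucc : (∀ v → pow σ (suc m) v ≡ v) →
                  ∀ v i → orbit σ v (cycSucc i) ≡ σ ⟨$⟩ʳ orbit σ v i
  orbit-cycSucc period v i =
    trans (cong (λ j → pow σ j v) (toℕ-cycSucc i)) (pow-% σ (suc m) period (suc (toℕ i)) v)

automorphism-pow : ∀ {n} (G : Graph n) {σ : Permutation′ n} → IsAutomorphism G σ →
                   ∀ k u v → adj G (pow σ k u) (pow σ k v) ≡ adj G u v
automorphism-pow G         aut zero    u v = refl
automorphism-pow G {σ = σ} aut (suc k) u v =
  trans (aut (pow σ k u) (pow σ k v)) (automorphism-pow G aut k u v)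

complement-automorphism : ∀ {n} (G : Graph n) {σ : Permutation′ n} →
                          IsAutomorphism G σ → IsAutomorphism (complement G) σ
complement-automorphism G {σ = σ} aut u v with σ ⟨$⟩ʳ u ≟ σ ⟨$⟩ʳ v | u ≟ v
... | yes _     | yes _   = refl
... | yes σu≡σv | no u≢v  = ⊥-elim (u≢v (Injection.injective (↔⇒↣ σ) σu≡σv))
... | no σu≢σv  | yes u≡v = ⊥-elim (σu≢σv (cong (σ ⟨$⟩ʳ_) u≡v))
... | no _      | no _    = cong not (aut u v)

complement-kSymmetricAut : ∀ {n k} (G : Graph n) {σ : Permutation′ n} →
                           IsKSymmetricAut k G σ → IsKSymmetricAut k (complement G) σ
complement-kSymmetricAut G {σ} (aut , period , free) =
  complement-automorphism G {σ} aut , period , free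

complement-adj : ∀ {n} (G : Graph n) {u v} → u ≢ v → adj G u v ≡ false → Adj (complement G) u v
complement-adj G {u} {v} u≢v nonadj with u ≟ v
... | yes u≡v = ⊥-elim (u≢v u≡v)
... | no _    = cong not nonadj

orbit-hamiltonian : ∀ {m} (H : Graph (suc m)) (σ : Permutation′ (suc m)) →
                    IsKSymmetricAut (suc m) H σ → ∀ v → Adj H v (σ ⟨$⟩ʳ v) → HamiltonianCycle H
orbit-hamiltonian H σ (aut , period , free) v v~σv =
  injective⇒permutation (orbit σ v) (orbit-injective free v) , edge
  where
  edge : ∀ i → Adj H (orbit σ v i) (orbit σ v (cycSucc i))
  edge i = begin
    adj H (orbit σ v i) (orbit σ v (cycSucc i))     ≡⟨ cong (adj H _) (orbit-cycSucc period v i) ⟩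
    adj H (pow σ k v) (σ ⟨$⟩ʳ pow σ k v)            ≡⟨ cong (adj H _) (sym (pow-comm σ k v)) ⟩
    adj H (pow σ k v) (pow σ k (σ ⟨$⟩ʳ v))          ≡⟨ automorphism-pow H aut k v (σ ⟨$⟩ʳ v) ⟩
    adj H v (σ ⟨$⟩ʳ v)                              ≡⟨ v~σv ⟩
    true                                            ∎
    where
    open ≡-Reasoning
    k : ℕ
    k = toℕ i

orbit-hamiltonian-or-complement : ∀ {m} (G : Graph (suc (suc m))) (σ : Permutation′ (suc (suc m))) →
  IsKSymmetricAut (suc (suc m)) G σ → ∀ v → HamiltonianCycle G ⊎ HamiltonianCycle (complement G)
orbit-hamiltonian-or-complement G σ symσ@(_ , _ , free) v with adj G v (σ ⟨$⟩ʳ v) in v~σv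
... | true  = inj₁ (orbit-hamiltonian G σ symσ v v~σv)
... | false = inj₂ (orbit-hamiltonian (complement G) σ (complement-kSymmetricAut G symσ) v
                     (complement-adj G σ-moves-v v~σv))
  where
  σ-moves-v : v ≢ σ ⟨$⟩ʳ v
  σ-moves-v v≡σv = free 1 (s≤s z≤n) (s≤s (s≤s z≤n)) v (sym v≡σv)

proposition3p2 : (n : ℕ) → 3 ≤ n → (G : Graph n) → KSymmetric n G →
    HamiltonianCycle G ⊎ HamiltonianCycle (complement G)
proposition3p2 (suc (suc m)) (s≤s (s≤s _)) G (_ , σ , symσ) = orbit-hamiltonian-or-complement G σ symσ zero
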